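{- The class of all finite graphs has the extension property for switching automorphisms: for every finite graph $\mathbf G$ there exists a finite graph $\mathbf H$ containing $\mathbf G$ as an induced subgraph such that (1) every switching isomorphism between two induced subgraphs of $\mathbf G$ extends to a switching automorphism of $\mathbf H$, and (2) every isomorphism between two induced subgraphs of $\mathbf G$ extends to an automorphism of $\mathbf H$.
   Context: Graphs are simple and undirected. For a graph $\mathbf G$ with vertex set $G$ and $S\subseteq G$, the (Seidel) switching $\mathbf G_S$ is the graph on $G$ obtained from $\mathbf G$ by complementing the edges between $S$ and $G\setminus S$: for $s\in S$, $t\in G\setminus S$, $\{s,t\}$ is an edge of $\mathbf G_S$ iff it is not an edge of $\mathbf G$; pairs with both endpoints in $S$ or both in $G\setminus S$ are unchanged. For graphs $\mathbf G,\mathbf H$, a map $f\colon G\to H$ is a switching isomorphism of $\mathbf G$ and $\mathbf H$ if there is $S\subseteq G$ such that $f$ is an isomorphism from $\mathbf G_S$ to $\mathbf H$; if $\mathbf G=\mathbf H$ it is called a switching automorphism. -}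

module Defs where

open import Data.Nat using (ℕ)
open import Data.Fin using (Fin)
open import Data.Fin.Subset using (Subset; _∈_)
open import Data.Bool using (Bool; true; false; not; if_then_else_; _xor_)
open import Data.Product using (Σ; ∃; _×_; proj₁)
open import Relation.Binary.PropositionalEquality using (_≡_)
open import Function.Definitions using (Bijective)

record Graph (n : ℕ) : Set where
  field
    adj    : Fin n → Fin n → Bool
    sym    : ∀ x y → adj x y ≡ adj y x
    irrefl : ∀ x → adj x x ≡ false
open Graph public

Sub : {n : ℕ} → Subset n → Set
Sub {n} A = Σ (Fin n) (λ x → x ∈ A)

inducedAdj : {n : ℕ} → Graph n → (A : Subset n) → Sub A → Sub A → Bool
inducedAdj G A x y = adj G (proj₁ x) (proj₁ y)

switch : {V : Set} → (V → V → Bool) → (V → Bool) → V → V → Bool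
switch a S x y = if S x xor S y then not (a x y) else a x y

IsIso : {V W : Set} → (V → V → Bool) → (W → W → Bool) → (V → W) → Set
IsIso {V} {W} a b f = Bijective _≡_ _≡_ f × (∀ x y → b (f x) (f y) ≡ a x y)

IsSwitchingIso : {V W : Set} → (V → V → Bool) → (W → W → Bool) → (V → W) → Set
IsSwitchingIso {V} a b f = Σ (V → Bool) (λ S → IsIso (switch a S) b f)

IsInducedEmbedding : {n m : ℕ} → Graph n → Graph m → (Fin n → Fin m) → Set
IsInducedEmbedding G H e =
  (∀ {x y} → e x ≡ e y → x ≡ y) × (∀ x y → adj H (e x) (e y) ≡ adj G x y)

Extends : {n m : ℕ} {A B : Subset n} → (Fin n → Fin m) →
          (Fin m → Fin m) → (Sub A → Sub B) → Set
Extends {A = A} e g f = ∀ (x : Sub A) → g (e (proj₁ x)) ≡ e (proj₁ (f x))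

module Submission where

-- Let X be a finite set with decidable equality.  The valuation graph Γ(X)
-- has as vertices the pairs (x , c) of a point x ∈ X and a Boolean labelling
-- c : X → Bool; vertices over distinct points x ≠ y are adjacent iff
-- c y xor c′ x, and vertices over the same point are never adjacent.
--
-- A permutation π of X together with a correction d : X → X → Bool induces
-- the bijection (x , c) ↦ (π x , w ↦ c (π⁻¹ w) xor d x (π⁻¹ w)) of Γ(X).  If
-- the symmetrisation d x y xor d y x equals s x xor s y, this map is a
-- switching automorphism with switching set s (lemma twist-switching).
-- Such a d can always be chosen with prescribed rows on a set P of points
-- when the prescription is coherent on P (correction-symmetrises); choosing
-- the rows well, the twist maps the "base vertex" of every point of P to
-- the base vertex of its π-image (extension-lemma).
--
-- A graph G on Fin n sits inside Γ(Fin n ⊎ Fin n) on the base vertices over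
-- the first copy, whose labels orient the edges of G along the order of
-- Fin n.  A partial (switching) isomorphism f : A → B of G extends to a
-- permutation of the doubled set Fin n ⊎ Fin n (the doubling trick), and
-- the extension lemma turns it into a switching automorphism of Γ(X)
-- extending f, which is an automorphism when f is an isomorphism.

open import Defs hiding (sym)
open import Data.Nat using (ℕ; zero; suc; _+_; _*_; _^_)
open import Data.Fin using (Fin; _<?_)
open import Data.Fin.Subset using (Subset)
open import Data.Fin.Subset.Properties using (_∈?_)
import Data.Fin.Properties as Fin
open import Data.Empty using (⊥-elim)
open import Data.Bool using (Bool; true; false; _∧_; _xor_; if_then_else_)
open import Data.Bool.Properties
  using (not-involutive; xor-assoc; xor-comm; xor-same; xor-identityʳ; xor-∧-commutativeRing)
open import Data.Maybe using (Maybe; just; nothing; maybe′)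
open import Data.Product using (Σ; _×_; _,_; proj₁; proj₂; uncurry)
open import Data.Product.Function.NonDependent.Propositional using (_×-↔_)
open import Data.Sum using (_⊎_; inj₁; inj₂; swap; reduce)
open import Data.Sum.Properties using (swap-involutive; inj₁-injective)
import Data.Sum.Properties as Sum
open import Data.Vec using (Vec; []; _∷_; lookup; tabulate)
open import Data.Vec.Properties using (lookup∘tabulate; tabulate∘lookup; tabulate-cong)
open import Data.Vec.Properties.WithK using ([]=-irrelevant)
open import Function using (_∘_)
open import Function.Bundles using (_↔_; Inverse; mk↔ₛ′; Bijection)
open import Function.Definitions using (Bijective)
open import Function.Properties.Inverse using (↔-sym; ↔-trans; Inverse⇒Bijection)
open import Algebra.Bundles using (CommutativeRing)
open import Algebra.Properties.CommutativeSemigroup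
  (CommutativeRing.+-commutativeSemigroup xor-∧-commutativeRing) using (interchange)
open import Relation.Binary.Definitions using (DecidableEquality; tri<; tri≈; tri>)
open import Relation.Binary.PropositionalEquality
  using (_≡_; _≢_; refl; sym; trans; cong; cong₂; module ≡-Reasoning)
open import Relation.Nullary using (yes; no; does)
open import Relation.Nullary.Decidable using (dec-true; dec-false)

open Inverse using (to; from; strictlyInverseˡ; strictlyInverseʳ)
open ≡-Reasoning

switch≡xor : {V : Set} (a : V → V → Bool) (S : V → Bool) →
             ∀ x y → switch a S x y ≡ (S x xor S y) xor a x y
switch≡xor a S x y with S x xor S y
... | true  = refl
... | false = refl

xor-cancelˡ : ∀ a b → a xor (a xor b) ≡ b
xor-cancelˡ false b = refl
xor-cancelˡ true  b = not-involutive b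

xor-cancelʳ : ∀ a b → (a xor b) xor b ≡ a
xor-cancelʳ a b = begin
  (a xor b) xor b  ≡⟨ xor-assoc a b b ⟩
  a xor (b xor b)  ≡⟨ cong (a xor_) (xor-same b) ⟩
  a xor false      ≡⟨ xor-identityʳ a ⟩
  a                ∎

xor-cancel-mixed : ∀ t a b → t xor ((t xor a) xor b) ≡ a xor b
xor-cancel-mixed t a b = trans (cong (t xor_) (xor-assoc t a b)) (xor-cancelˡ t (a xor b))

by-decision : {Y : Set} → DecidableEquality Y → {Q : Y → Y → Set} →
              (∀ x → Q x x) → (∀ {x y} → x ≢ y → Q x y) → ∀ x y → Q x y
by-decision _≟_ same distinct x y with x ≟ y
... | yes refl = same x
... | no x≢y   = distinct x≢y

uncons↔ : {A : Set} {k : ℕ} → Vec A (suc k) ↔ (A × Vec A k)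
uncons↔ = mk↔ₛ′ (λ { (x ∷ xs) → x , xs }) (uncurry _∷_) (λ _ → refl) (λ { (x ∷ xs) → refl })

vecBool↔ : (k : ℕ) → Vec Bool k ↔ Fin (2 ^ k)
vecBool↔ zero    = mk↔ₛ′ (λ _ → Fin.zero) (λ _ → []) (λ { Fin.zero → refl ; (Fin.suc ()) }) (λ { [] → refl })
vecBool↔ (suc k) = ↔-trans uncons↔ (↔-trans (↔-sym Fin.2↔Bool ×-↔ vecBool↔ k) (↔-sym Fin.*↔×))

module Transport {V : Set} {m : ℕ} (enc : V ↔ Fin m) (R : V → V → Bool)
                 (R-sym : ∀ u v → R u v ≡ R v u) (R-irrefl : ∀ u → R u u ≡ false) where

  graph : Graph m
  graph = record
    { adj    = λ i j → R (from enc i) (from enc j)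
    ; sym    = λ i j → R-sym (from enc i) (from enc j)
    ; irrefl = λ i → R-irrefl (from enc i) }

  decode-encode : ∀ v → from enc (to enc v) ≡ v
  decode-encode = strictlyInverseʳ enc

  embedding : {n : ℕ} (G : Graph n) (e : Fin n → V) → (∀ {x y} → e x ≡ e y → x ≡ y) →
              (∀ x y → R (e x) (e y) ≡ adj G x y) → IsInducedEmbedding G graph (to enc ∘ e)
  embedding G e e-inj e-adj =
      (λ {x} {y} eq → e-inj (trans (sym (decode-encode (e x)))
                              (trans (cong (from enc) eq) (decode-encode (e y)))))
    , λ x y → trans (cong₂ R (decode-encode (e x)) (decode-encode (e y))) (e-adj x y)

  conj : V ↔ V → Fin m ↔ Fin m
  conj g = ↔-trans (↔-sym enc) (↔-trans g enc)

  conj-switching : (g : V ↔ V) (σ : V → Bool) →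
                   (∀ u v → R (to g u) (to g v) ≡ switch R σ u v) →
                   IsIso (switch (adj graph) (σ ∘ from enc)) (adj graph) (to (conj g))
  conj-switching g σ g-sw =
      Bijection.bijective (Inverse⇒Bijection (conj g))
    , λ i j → trans (cong₂ R (decode-encode (to g (from enc i))) (decode-encode (to g (from enc j))))
                    (g-sw (from enc i) (from enc j))

  conj-maps : (g : V ↔ V) {v w : V} → to g v ≡ w → to (conj g) (to enc v) ≡ to enc w
  conj-maps g {v} gv≡w = cong (to enc) (trans (cong (to g) (decode-encode v)) gv≡w)

module Valuation {X : Set} {k : ℕ} (enum : X ↔ Fin k) (_≟_ : DecidableEquality X) where

  -- Labellings c : X → Bool, stored as vectors indexed through enum.
  Labelling : Set
  Labelling = Vec Bool k

  Vertex : Set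
  Vertex = X × Labelling

  enumerate : Vertex ↔ Fin (k * 2 ^ k)
  enumerate = ↔-trans (enum ×-↔ vecBool↔ k) (↔-sym Fin.*↔×)

  lk : Labelling → X → Bool
  lk c x = lookup c (to enum x)

  tb : (X → Bool) → Labelling
  tb F = tabulate (F ∘ from enum)

  lk-tb : ∀ F x → lk (tb F) x ≡ F x
  lk-tb F x = trans (lookup∘tabulate (F ∘ from enum) (to enum x)) (cong F (strictlyInverseʳ enum x))

  tb-lk : ∀ c → tb (lk c) ≡ c
  tb-lk c = trans (tabulate-cong (λ i → cong (lookup c) (strictlyInverseˡ enum i))) (tabulate∘lookup c)

  tb-cong : ∀ {F F′} → (∀ x → F x ≡ F′ x) → tb F ≡ tb F′
  tb-cong F≗F′ = tabulate-cong (F≗F′ ∘ from enum)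

  adjΓ : Vertex → Vertex → Bool
  adjΓ (x , c) (y , c′) = if does (x ≟ y) then false else lk c y xor lk c′ x

  adjΓ-same : ∀ x c c′ → adjΓ (x , c) (x , c′) ≡ false
  adjΓ-same x c c′ rewrite dec-true (x ≟ x) refl = refl

  adjΓ-distinct : ∀ {x y} c c′ → x ≢ y → adjΓ (x , c) (y , c′) ≡ lk c y xor lk c′ x
  adjΓ-distinct {x} {y} c c′ x≢y rewrite dec-false (x ≟ y) x≢y = refl

  adjΓ-sym : ∀ u v → adjΓ u v ≡ adjΓ v u
  adjΓ-sym (x , c) (y , c′) = by-decision _≟_ {Q = λ x y → adjΓ (x , c) (y , c′) ≡ adjΓ (y , c′) (x , c)}
    (λ x → trans (adjΓ-same x c c′) (sym (adjΓ-same x c′ c)))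
    (λ {x} {y} x≢y → trans (adjΓ-distinct c c′ x≢y)
                      (trans (xor-comm (lk c y) (lk c′ x)) (sym (adjΓ-distinct c′ c (x≢y ∘ sym)))))
    x y

  adjΓ-irrefl : ∀ u → adjΓ u u ≡ false
  adjΓ-irrefl (x , c) = adjΓ-same x c c

  base : (X → X → Bool) → X → Vertex
  base χ u = u , tb (χ u)

  base-adj : (χ : X → X → Bool) {u z : X} → u ≢ z → adjΓ (base χ u) (base χ z) ≡ χ u z xor χ z u
  base-adj χ {u} {z} u≢z = trans (adjΓ-distinct (tb (χ u)) (tb (χ z)) u≢z) (cong₂ _xor_ (lk-tb (χ u) z) (lk-tb (χ z) u))

  Symmetrises : (X → X → Bool) → (X → Bool) → Set
  Symmetrises d s = ∀ x y → x ≢ y → d x y xor d y x ≡ s x xor s y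

  module Twist (π : X ↔ X) (d : X → X → Bool) where

    private
      π⁻¹π : ∀ x → from π (to π x) ≡ x
      π⁻¹π = strictlyInverseʳ π

    relabel : X → Labelling → Labelling
    relabel x c = tb (λ w → lk c (from π w) xor d x (from π w))

    twist : Vertex ↔ Vertex
    twist = mk↔ₛ′ forward backward forward-backward backward-forward
      where
        forward : Vertex → Vertex
        forward (x , c) = to π x , relabel x c

        backward : Vertex → Vertex
        backward (y , c) = from π y , tb (λ z → lk c (to π z) xor d (from π y) z)

        forward-backward : ∀ v → forward (backward v) ≡ v
        forward-backward (y , c) = cong₂ _,_ (strictlyInverseˡ π y) (trans (tb-cong pointwise) (tb-lk c))
          where
            y′ : X
            y′ = from π y
            pointwise : ∀ w → lk (tb (λ z → lk c (to π z) xor d y′ z)) (from π w) xor d y′ (from π w) ≡ lk c w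
            pointwise w = begin
              lk (tb (λ z → lk c (to π z) xor d y′ z)) (from π w) xor d y′ (from π w)
                ≡⟨ cong (_xor d y′ (from π w)) (lk-tb (λ z → lk c (to π z) xor d y′ z) (from π w)) ⟩
              (lk c (to π (from π w)) xor d y′ (from π w)) xor d y′ (from π w)
                ≡⟨ xor-cancelʳ (lk c (to π (from π w))) (d y′ (from π w)) ⟩
              lk c (to π (from π w))
                ≡⟨ cong (lk c) (strictlyInverseˡ π w) ⟩
              lk c w ∎

        backward-forward : ∀ v → backward (forward v) ≡ v
        backward-forward (x , c) = cong₂ _,_ (π⁻¹π x) (trans (tb-cong pointwise) (tb-lk c))
          where
            pointwise : ∀ z → lk (relabel x c) (to π z) xor d (from π (to π x)) z ≡ lk c z
            pointwise z = begin
              lk (relabel x c) (to π z) xor d (from π (to π x)) z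
                ≡⟨ cong (_xor d (from π (to π x)) z) (lk-tb (λ w → lk c (from π w) xor d x (from π w)) (to π z)) ⟩
              (lk c (from π (to π z)) xor d x (from π (to π z))) xor d (from π (to π x)) z
                ≡⟨ cong₂ (λ z′ x′ → (lk c z′ xor d x z′) xor d x′ z) (π⁻¹π z) (π⁻¹π x) ⟩
              (lk c z xor d x z) xor d x z
                ≡⟨ xor-cancelʳ (lk c z) (d x z) ⟩
              lk c z ∎

    relabel-at : ∀ x c y → lk (relabel x c) (to π y) ≡ lk c y xor d x y
    relabel-at x c y = trans (lk-tb (λ w → lk c (from π w) xor d x (from π w)) (to π y)) (cong (λ y′ → lk c y′ xor d x y′) (π⁻¹π y))

    twist-switching : (s : X → Bool) → Symmetrises d s →
                      ∀ u v → adjΓ (to twist u) (to twist v) ≡ switch adjΓ (s ∘ proj₁) u v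
    twist-switching s d-sym (x , c) (y , c′) = by-decision _≟_ {Q = Goal} same distinct x y
      where
        Goal : X → X → Set
        Goal x y = adjΓ (to twist (x , c)) (to twist (y , c′)) ≡ switch adjΓ (s ∘ proj₁) (x , c) (y , c′)

        same : ∀ x → Goal x x
        same x = begin
          adjΓ (to π x , relabel x c) (to π x , relabel x c′)  ≡⟨ adjΓ-same (to π x) (relabel x c) (relabel x c′) ⟩
          false                                                ≡⟨ sym (cong₂ _xor_ (xor-same (s x)) (adjΓ-same x c c′)) ⟩
          (s x xor s x) xor adjΓ (x , c) (x , c′)              ≡⟨ sym (switch≡xor adjΓ (s ∘ proj₁) (x , c) (x , c′)) ⟩
          switch adjΓ (s ∘ proj₁) (x , c) (x , c′)             ∎

        distinct : ∀ {x y} → x ≢ y → Goal x y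
        distinct {x} {y} x≢y = begin
          adjΓ (to π x , relabel x c) (to π y , relabel y c′)
            ≡⟨ adjΓ-distinct (relabel x c) (relabel y c′) (λ eq → x≢y (trans (sym (π⁻¹π x)) (trans (cong (from π) eq) (π⁻¹π y)))) ⟩
          lk (relabel x c) (to π y) xor lk (relabel y c′) (to π x)
            ≡⟨ cong₂ _xor_ (relabel-at x c y) (relabel-at y c′ x) ⟩
          (lk c y xor d x y) xor (lk c′ x xor d y x)
            ≡⟨ interchange (lk c y) (d x y) (lk c′ x) (d y x) ⟩
          (lk c y xor lk c′ x) xor (d x y xor d y x)
            ≡⟨ cong₂ _xor_ (sym (adjΓ-distinct c c′ x≢y)) (d-sym x y x≢y) ⟩
          adjΓ (x , c) (y , c′) xor (s x xor s y)
            ≡⟨ xor-comm (adjΓ (x , c) (y , c′)) (s x xor s y) ⟩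
          (s x xor s y) xor adjΓ (x , c) (y , c′)
            ≡⟨ sym (switch≡xor adjΓ (s ∘ proj₁) (x , c) (y , c′)) ⟩
          switch adjΓ (s ∘ proj₁) (x , c) (y , c′) ∎

  -- A correction with prescribed rows T u on the points u ∈ P; outside P it
  -- is chosen so that the symmetrisation becomes the coboundary of s.
  correction : (P : X → Bool) (T : X → X → Bool) (s : X → Bool) → X → X → Bool
  correction P T s u z = if P u then T u z else (if P z then (T z u xor s z) xor s u else s u)

  correction-symmetrises : (P : X → Bool) (T : X → X → Bool) (s : X → Bool) →
    (∀ u z → u ≢ z → P u ≡ true → P z ≡ true → T u z xor T z u ≡ s u xor s z) →
    Symmetrises (correction P T s) s
  correction-symmetrises P T s coherent u z u≢z with P u in Pu | P z in Pz
  ... | true  | true  = coherent u z u≢z Pu Pz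
  ... | true  | false = xor-cancel-mixed (T u z) (s u) (s z)
  ... | false | true  = begin
    ((T z u xor s z) xor s u) xor T z u  ≡⟨ xor-comm _ (T z u) ⟩
    T z u xor ((T z u xor s z) xor s u)  ≡⟨ xor-cancel-mixed (T z u) (s z) (s u) ⟩
    s z xor s u                          ≡⟨ xor-comm (s z) (s u) ⟩
    s u xor s z                          ∎
  ... | false | false = refl

  correction-on-P : (P : X → Bool) (T : X → X → Bool) (s : X → Bool) →
                    ∀ {u} z → P u ≡ true → correction P T s u z ≡ T u z
  correction-on-P P T s {u} z Pu rewrite Pu = refl

  extension-lemma : (χ : X → X → Bool) (π : X ↔ X) (P : X → Bool) (s : X → Bool) →
    (∀ u z → u ≢ z → P u ≡ true → P z ≡ true →
       (χ u z xor χ z u) xor (χ (to π u) (to π z) xor χ (to π z) (to π u)) ≡ s u xor s z) →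
    Σ (Vertex ↔ Vertex) λ g →
      (∀ v w → adjΓ (to g v) (to g w) ≡ switch adjΓ (s ∘ proj₁) v w)
      × (∀ u → P u ≡ true → to g (base χ u) ≡ base χ (to π u))
  extension-lemma χ π P s coherent =
    twist , twist-switching s (correction-symmetrises P T s T-coherent) , maps-base
    where
      -- The row T u is forced by requiring g (base χ u) ≡ base χ (π u).
      T : X → X → Bool
      T u z = χ u z xor χ (to π u) (to π z)

      d : X → X → Bool
      d = correction P T s

      open Twist π d

      T-coherent : ∀ u z → u ≢ z → P u ≡ true → P z ≡ true → T u z xor T z u ≡ s u xor s z
      T-coherent u z u≢z Pu Pz =
        trans (interchange (χ u z) (χ (to π u) (to π z)) (χ z u) (χ (to π z) (to π u)))
              (coherent u z u≢z Pu Pz)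

      maps-base : ∀ u → P u ≡ true → to twist (base χ u) ≡ base χ (to π u)
      maps-base u Pu = cong (to π u ,_) (tb-cong pointwise)
        where
          pointwise : ∀ w → lk (tb (χ u)) (from π w) xor d u (from π w) ≡ χ (to π u) w
          pointwise w = begin
            lk (tb (χ u)) (from π w) xor d u (from π w)
              ≡⟨ cong₂ _xor_ (lk-tb (χ u) (from π w)) (correction-on-P P T s (from π w) Pu) ⟩
            χ u (from π w) xor (χ u (from π w) xor χ (to π u) (to π (from π w)))
              ≡⟨ xor-cancelˡ (χ u (from π w)) (χ (to π u) (to π (from π w))) ⟩
            χ (to π u) (to π (from π w))
              ≡⟨ cong (χ (to π u)) (strictlyInverseˡ π w) ⟩
            χ (to π u) w ∎

sub-≡ : {n : ℕ} {C : Subset n} {a b : Sub C} → proj₁ a ≡ proj₁ b → a ≡ b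
sub-≡ {a = x , p} {.x , q} refl = cong (x ,_) ([]=-irrelevant p q)

member : {n : ℕ} (C : Subset n) → Fin n → Maybe (Sub C)
member C x with x ∈? C
... | yes x∈C = just (x , x∈C)
... | no  _   = nothing

member-sub : {n : ℕ} {C : Subset n} (a : Sub C) → member C (proj₁ a) ≡ just a
member-sub {C = C} (x , x∈C) with x ∈? C
... | yes x∈C′ = cong (λ p → just (x , p)) ([]=-irrelevant x∈C′ x∈C)
... | no  x∉C  = ⊥-elim (x∉C x∈C)

member-just : {n : ℕ} {C : Subset n} {x : Fin n} {a : Sub C} → member C x ≡ just a → proj₁ a ≡ x
member-just {C = C} {x} eq with x ∈? C
member-just refl | yes _ = refl
member-just ()   | no  _

extend-set : {n : ℕ} {C : Subset n} → (Sub C → Bool) → Fin n → Bool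
extend-set {C = C} S x = maybe′ S false (member C x)

extend-set-sub : {n : ℕ} {C : Subset n} (S : Sub C → Bool) (a : Sub C) → extend-set S (proj₁ a) ≡ S a
extend-set-sub S a rewrite member-sub a = refl

induced-switch : {n : ℕ} (G : Graph n) {A : Subset n} (S : Sub A → Bool) (a b : Sub A) →
                 switch (inducedAdj G A) S a b ≡ switch (adj G) (extend-set S) (proj₁ a) (proj₁ b)
induced-switch {n} G {A} S a b = begin
  switch (inducedAdj G A) S a b
    ≡⟨ switch≡xor (inducedAdj G A) S a b ⟩
  (S a xor S b) xor adj G x y
    ≡⟨ cong₂ (λ p q → (p xor q) xor adj G x y) (sym (extend-set-sub S a)) (sym (extend-set-sub S b)) ⟩
  (extend-set S x xor extend-set S y) xor adj G x y
    ≡⟨ sym (switch≡xor (adj G) (extend-set S) x y) ⟩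
  switch (adj G) (extend-set S) x y ∎
  where
    x y : Fin n
    x = proj₁ a
    y = proj₁ b

-- The doubling trick: a partial bijection f : A → B of Fin n extends to a
-- permutation of Fin n ⊎ Fin n.  A point x ∈ A of the first copy goes to
-- f x in the first copy, any other x to its twin in the second copy; the
-- second copy is treated symmetrically with f⁻¹.

module _ {n : ℕ} {A B : Subset n} where

  half : (Sub A → Sub B) → Fin n → Fin n ⊎ Fin n
  half f x = maybe′ (λ a → inj₁ (proj₁ (f a))) (inj₂ x) (member A x)

  half-member : (f : Sub A → Sub B) (a : Sub A) → half f (proj₁ a) ≡ inj₁ (proj₁ (f a))
  half-member f a rewrite member-sub a = refl

double : {n : ℕ} {A B : Subset n} → (Sub A → Sub B) → (Sub B → Sub A) → Fin n ⊎ Fin n → Fin n ⊎ Fin n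
double f g (inj₁ x) = half f x
double f g (inj₂ y) = swap (half g y)

double-swap : {n : ℕ} {A B : Subset n} (f : Sub A → Sub B) (g : Sub B → Sub A) →
              ∀ w → double g f (swap w) ≡ swap (double f g w)
double-swap f g (inj₁ x) = refl
double-swap f g (inj₂ y) = sym (swap-involutive (half g y))

half-return : {n : ℕ} {A B : Subset n} (f : Sub A → Sub B) (g : Sub B → Sub A) →
              (∀ a → g (f a) ≡ a) → ∀ x → double g f (half f x) ≡ inj₁ x
half-return {A = A} f g g∘f x with member A x in eq
... | just a  = begin
  half g (proj₁ (f a))  ≡⟨ half-member g (f a) ⟩
  inj₁ (proj₁ (g (f a))) ≡⟨ cong (inj₁ ∘ proj₁) (g∘f a) ⟩
  inj₁ (proj₁ a)         ≡⟨ cong inj₁ (member-just eq) ⟩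
  inj₁ x                 ∎
... | nothing = cong (swap ∘ maybe′ (λ a → inj₁ (proj₁ (f a))) (inj₂ x)) eq

double-inverse : {n : ℕ} {A B : Subset n} (f : Sub A → Sub B) (g : Sub B → Sub A) →
                 (∀ a → g (f a) ≡ a) → (∀ b → f (g b) ≡ b) → ∀ x → double g f (double f g x) ≡ x
double-inverse f g g∘f f∘g (inj₁ x) = half-return f g g∘f x
double-inverse f g g∘f f∘g (inj₂ y) =
  trans (double-swap f g (half g y)) (cong swap (half-return g f f∘g y))

doubling : {n : ℕ} {A B : Subset n} (f : Sub A → Sub B) → Bijective _≡_ _≡_ f →
           (Fin n ⊎ Fin n) ↔ (Fin n ⊎ Fin n)
doubling {A = A} {B} f (f-inj , f-surj) =
  mk↔ₛ′ (double f f⁻¹) (double f⁻¹ f) (double-inverse f⁻¹ f f∘f⁻¹ f⁻¹∘f) (double-inverse f f⁻¹ f⁻¹∘f f∘f⁻¹)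
  where
    f⁻¹ : Sub B → Sub A
    f⁻¹ b = proj₁ (f-surj b)

    f∘f⁻¹ : ∀ b → f (f⁻¹ b) ≡ b
    f∘f⁻¹ b = proj₂ (f-surj b) refl

    f⁻¹∘f : ∀ a → f⁻¹ (f a) ≡ a
    f⁻¹∘f a = f-inj (f∘f⁻¹ (f a))

module Construction {n : ℕ} (G : Graph n) where

  X : Set
  X = Fin n ⊎ Fin n

  open Valuation {X} (↔-sym Fin.+↔⊎) (Sum.≡-dec Fin._≟_ Fin._≟_) public

  -- Each edge of G is recorded in the label of its smaller endpoint.
  χ : X → X → Bool
  χ (inj₁ a) (inj₁ b) = does (a <? b) ∧ adj G a b
  χ _        _        = false

  χ-orients : ∀ {a b} → a ≢ b → χ (inj₁ a) (inj₁ b) xor χ (inj₁ b) (inj₁ a) ≡ adj G a b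
  χ-orients {a} {b} a≢b with Fin.<-cmp a b
  ... | tri< a<b _ b≮a rewrite dec-true (a <? b) a<b | dec-false (b <? a) b≮a = xor-identityʳ (adj G a b)
  ... | tri≈ _ a≡b _   = ⊥-elim (a≢b a≡b)
  ... | tri> a≮b _ b<a rewrite dec-false (a <? b) a≮b | dec-true (b <? a) b<a = Graph.sym G b a

  embedΓ : Fin n → Vertex
  embedΓ a = base χ (inj₁ a)

  embedΓ-injective : ∀ {a b} → embedΓ a ≡ embedΓ b → a ≡ b
  embedΓ-injective = inj₁-injective ∘ cong proj₁

  embedΓ-adj : ∀ a b → adjΓ (embedΓ a) (embedΓ b) ≡ adj G a b
  embedΓ-adj = by-decision Fin._≟_ {Q = λ a b → adjΓ (embedΓ a) (embedΓ b) ≡ adj G a b}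
    (λ a → trans (adjΓ-irrefl (embedΓ a)) (sym (Graph.irrefl G a)))
    (λ a≢b → trans (base-adj χ (a≢b ∘ inj₁-injective)) (χ-orients a≢b))

  inA : Subset n → X → Bool
  inA A (inj₁ x) = does (x ∈? A)
  inA A (inj₂ _) = false

  inA-true : {A : Subset n} → ∀ u → inA A u ≡ true → Σ (Sub A) λ a → u ≡ inj₁ (proj₁ a)
  inA-true {A} (inj₁ x) eq with x ∈? A
  ... | yes x∈A = (x , x∈A) , refl
  inA-true (inj₂ _) ()

  extend-in-Γ : {A B : Subset n} (f : Sub A → Sub B) (f-bij : Bijective _≡_ _≡_ f) (s : Fin n → Bool) →
    (∀ a b → adj G (proj₁ (f a)) (proj₁ (f b)) ≡ switch (adj G) s (proj₁ a) (proj₁ b)) →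
    Σ (Vertex ↔ Vertex) λ g →
      (∀ v w → adjΓ (to g v) (to g w) ≡ switch adjΓ (s ∘ reduce ∘ proj₁) v w)
      × (∀ a → to g (embedΓ (proj₁ a)) ≡ embedΓ (proj₁ (f a)))
  extend-in-Γ {A} f f-bij s f-sw =
    let g , g-sw , g-base = extension-lemma χ π (inA A) (s ∘ reduce) coherent
    in  g , g-sw , λ a → trans (g-base (inj₁ (proj₁ a)) (dec-true (proj₁ a ∈? A) (proj₂ a)))
                               (cong (base χ) (half-member f a))
    where
      π : X ↔ X
      π = doubling f f-bij

      f-injective : ∀ {a b} → proj₁ a ≢ proj₁ b → proj₁ (f a) ≢ proj₁ (f b)
      f-injective a≢b fa≡fb = a≢b (cong proj₁ (proj₁ f-bij (sub-≡ fa≡fb)))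

      coherent : ∀ u z → u ≢ z → inA A u ≡ true → inA A z ≡ true →
        (χ u z xor χ z u) xor (χ (to π u) (to π z) xor χ (to π z) (to π u)) ≡ s (reduce u) xor s (reduce z)
      coherent u z u≢z Au Az with inA-true u Au | inA-true z Az
      ... | a , refl | b , refl = begin
        (χ (inj₁ x) (inj₁ y) xor χ (inj₁ y) (inj₁ x)) xor (χ (to π (inj₁ x)) (to π (inj₁ y)) xor χ (to π (inj₁ y)) (to π (inj₁ x)))
          ≡⟨ cong₂ (λ p q → (χ (inj₁ x) (inj₁ y) xor χ (inj₁ y) (inj₁ x)) xor (χ p q xor χ q p))
                   (half-member f a) (half-member f b) ⟩
        (χ (inj₁ x) (inj₁ y) xor χ (inj₁ y) (inj₁ x)) xor (χ (inj₁ fx) (inj₁ fy) xor χ (inj₁ fy) (inj₁ fx))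
          ≡⟨ cong₂ _xor_ (χ-orients x≢y) (χ-orients (f-injective x≢y)) ⟩
        adj G x y xor adj G fx fy
          ≡⟨ cong (adj G x y xor_) (trans (f-sw a b) (switch≡xor (adj G) s x y)) ⟩
        adj G x y xor ((s x xor s y) xor adj G x y)
          ≡⟨ cong (adj G x y xor_) (xor-comm (s x xor s y) (adj G x y)) ⟩
        adj G x y xor (adj G x y xor (s x xor s y))
          ≡⟨ xor-cancelˡ (adj G x y) (s x xor s y) ⟩
        s x xor s y ∎
        where
          x y fx fy : Fin n
          x = proj₁ a
          y = proj₁ b
          fx = proj₁ (f a)
          fy = proj₁ (f b)
          x≢y : x ≢ y
          x≢y = u≢z ∘ cong inj₁

  m : ℕ
  m = (n + n) * 2 ^ (n + n)

  open Transport enumerate adjΓ adjΓ-sym adjΓ-irrefl public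

  H : Graph m
  H = graph

  e : Fin n → Fin m
  e = to enumerate ∘ embedΓ

  e-embedding : IsInducedEmbedding G H e
  e-embedding = embedding G embedΓ embedΓ-injective embedΓ-adj

  extend : {A B : Subset n} (f : Sub A → Sub B) → Bijective _≡_ _≡_ f → (s : Fin n → Bool) →
    (∀ a b → adj G (proj₁ (f a)) (proj₁ (f b)) ≡ switch (adj G) s (proj₁ a) (proj₁ b)) →
    Σ (Fin m → Fin m) λ g → IsIso (switch (adj H) (s ∘ reduce ∘ proj₁ ∘ from enumerate)) (adj H) g × Extends e g f
  extend f f-bij s f-sw =
    let g , g-sw , g-ext = extend-in-Γ f f-bij s f-sw
    in  to (conj g) , conj-switching g (s ∘ reduce ∘ proj₁) g-sw , λ a → conj-maps g {embedΓ (proj₁ a)} (g-ext a)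

theorem1p3 : (n : ℕ) (G : Graph n) →
    Σ ℕ λ m → Σ (Graph m) λ H → Σ (Fin n → Fin m) λ e →
      IsInducedEmbedding G H e
      × ((A B : Subset n) (f : Sub A → Sub B) →
          IsSwitchingIso (inducedAdj G A) (inducedAdj G B) f →
          Σ (Fin m → Fin m) λ g → IsSwitchingIso (adj H) (adj H) g × Extends e g f)
      × ((A B : Subset n) (f : Sub A → Sub B) →
          IsIso (inducedAdj G A) (inducedAdj G B) f →
          Σ (Fin m → Fin m) λ g → IsIso (adj H) (adj H) g × Extends e g f)
theorem1p3 n G = m , H , e , e-embedding , switching-extension , iso-extension
  where
    open Construction G

    switching-extension : (A B : Subset n) (f : Sub A → Sub B) →
      IsSwitchingIso (inducedAdj G A) (inducedAdj G B) f →
      Σ (Fin m → Fin m) λ g → IsSwitchingIso (adj H) (adj H) g × Extends e g f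
    switching-extension A B f (S , f-bij , f-sw) =
      let g , g-iso , g-ext = extend f f-bij (extend-set S) (λ a b → trans (f-sw a b) (induced-switch G S a b))
      in  g , (extend-set S ∘ reduce ∘ proj₁ ∘ from enumerate , g-iso) , g-ext

    -- An isomorphism is a switching isomorphism with empty switching set.
    iso-extension : (A B : Subset n) (f : Sub A → Sub B) →
      IsIso (inducedAdj G A) (inducedAdj G B) f →
      Σ (Fin m → Fin m) λ g → IsIso (adj H) (adj H) g × Extends e g f
    iso-extension A B f (f-bij , f-iso) = extend f f-bij (λ _ → false) f-iso
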